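{- Every quiddity cycle $c\notin\{(\!(0,0)\!),(\!(1,1,1)\!),(\!(1,2,1,2)\!)\}$ contains at least one of \begin{eqnarray*} &&(1,2,2,1),(1,2,2,2),(1,2,2,3),(1,2,2,4),(1,2,3,1),(1,2,3,2),\\ &&(1,2,3,3),(1,2,4,1),(1,2,4,3),(1,2,5,1),(1,2,5,2),(1,2,6,1),\\ &&(1,3,1,3),(1,3,1,4),(1,3,1,5),(1,3,1,6),(1,3,4,1),(1,4,1,2),\\ &&(1,5,1,2),(1,6,1,2),(1,7,1,2),(2,1,3,2),(2,1,3,3),(2,2,1,4),\\ &&(2,2,1,5),(3,1,2,3),(3,1,2,4). \end{eqnarray*}
   Context: A finite sequence is an element of $\mathbb{N}_0^n$ for some $n\ge1$. $(\!(c_1,\dots,c_n)\!)$ denotes the orbit of $(c_1,\dots,c_n)$ under the dihedral group acting on positions (rotations and reversal); its elements are representatives. Quiddity cycles form the smallest set $\mathcal{A}$ of such orbits containing $(\!(0,0)\!)$ and such that $(\!(c_1,\dots,c_n)\!)\in\mathcal{A}$ (any representative) implies $(\!(c_1+1,1,c_2+1,c_3,\dots,c_n)\!)\in\mathcal{A}$. A sequence $(d_1,\dots,d_m)$ is contained in $c$ if there are a representative $(c_1,\dots,c_n)$ of $c$ and $k\ge0$ with $c_{k+i}=d_i$ for $i=1,\dots,m$, indices read cyclically modulo $n$. -}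

module Defs where

open import Data.Nat using (ℕ; zero; suc; _+_; _%_)
open import Data.Nat.DivMod using (m%n<n)
open import Data.Fin using (Fin; toℕ; fromℕ<)
open import Data.List using (List; []; _∷_; _∷ʳ_; reverse; length; lookup)
open import Data.Product using (Σ; ∃; _×_)
open import Relation.Binary.PropositionalEquality using (_≡_)

-- Two sequences are Dih-related iff they represent the same orbit ((…)).
data Dih : List ℕ → List ℕ → Set where
  dih-refl  : ∀ {l} → Dih l l
  dih-rot   : ∀ {x xs} → Dih (x ∷ xs) (xs ∷ʳ x)
  dih-rev   : ∀ {l} → Dih l (reverse l)
  dih-sym   : ∀ {l l'} → Dih l l' → Dih l' l
  dih-trans : ∀ {l l' l''} → Dih l l' → Dih l' l'' → Dih l l''

-- Encoded as a predicate on representatives, closed under the dihedral action.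
data Quiddity : List ℕ → Set where
  q-base : Quiddity (0 ∷ 0 ∷ [])
  q-dih  : ∀ {l l'} → Dih l l' → Quiddity l → Quiddity l'
  q-grow : ∀ {c₁ c₂ rest} → Quiddity (c₁ ∷ c₂ ∷ rest)
         → Quiddity (suc c₁ ∷ 1 ∷ suc c₂ ∷ rest)

-- Cyclic indexing: cycAt (c₁,…,cₙ) j = c_{(j mod n)+1}  (0-based j).
cycAt : List ℕ → ℕ → ℕ
cycAt []       j = 0
cycAt (x ∷ xs) j = lookup (x ∷ xs) (fromℕ< (m%n<n j (suc (length xs))))

ContainedIn : List ℕ → List ℕ → Set
ContainedIn d c =
  Σ (List ℕ) λ r → Dih c r ×
    Σ ℕ λ k → (i : Fin (length d)) → cycAt r (k + toℕ i) ≡ lookup d i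

patterns : List (List ℕ)
patterns =
  (1 ∷ 2 ∷ 2 ∷ 1 ∷ []) ∷ (1 ∷ 2 ∷ 2 ∷ 2 ∷ []) ∷ (1 ∷ 2 ∷ 2 ∷ 3 ∷ []) ∷
  (1 ∷ 2 ∷ 2 ∷ 4 ∷ []) ∷ (1 ∷ 2 ∷ 3 ∷ 1 ∷ []) ∷ (1 ∷ 2 ∷ 3 ∷ 2 ∷ []) ∷
  (1 ∷ 2 ∷ 3 ∷ 3 ∷ []) ∷ (1 ∷ 2 ∷ 4 ∷ 1 ∷ []) ∷ (1 ∷ 2 ∷ 4 ∷ 3 ∷ []) ∷
  (1 ∷ 2 ∷ 5 ∷ 1 ∷ []) ∷ (1 ∷ 2 ∷ 5 ∷ 2 ∷ []) ∷ (1 ∷ 2 ∷ 6 ∷ 1 ∷ []) ∷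
  (1 ∷ 3 ∷ 1 ∷ 3 ∷ []) ∷ (1 ∷ 3 ∷ 1 ∷ 4 ∷ []) ∷ (1 ∷ 3 ∷ 1 ∷ 5 ∷ []) ∷
  (1 ∷ 3 ∷ 1 ∷ 6 ∷ []) ∷ (1 ∷ 3 ∷ 4 ∷ 1 ∷ []) ∷ (1 ∷ 4 ∷ 1 ∷ 2 ∷ []) ∷
  (1 ∷ 5 ∷ 1 ∷ 2 ∷ []) ∷ (1 ∷ 6 ∷ 1 ∷ 2 ∷ []) ∷ (1 ∷ 7 ∷ 1 ∷ 2 ∷ []) ∷
  (2 ∷ 1 ∷ 3 ∷ 2 ∷ []) ∷ (2 ∷ 1 ∷ 3 ∷ 3 ∷ []) ∷ (2 ∷ 2 ∷ 1 ∷ 4 ∷ []) ∷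
  (2 ∷ 2 ∷ 1 ∷ 5 ∷ []) ∷ (3 ∷ 1 ∷ 2 ∷ 3 ∷ []) ∷ (3 ∷ 1 ∷ 2 ∷ 4 ∷ []) ∷ []

-- Quiddity cycles are the quiddities of triangulated polygons, which we encode by binary trees:
-- a leaf is the 2-gon ((0,0)), and node A B glues a triangle onto the root edges of A and B.
-- Rotation, reflection and the growth step of quiddity cycles become rerooting, mirroring and
-- grafting a triangle at the leftmost leaf, so every quiddity cycle is the cycle of a tree.
-- The vertices strictly inside a subtree S lie only in triangles of S, so their entries form a
-- block of consecutive entries of the whole cycle that depends on S alone. A tree of height at
-- least 4 has a subtree of height exactly 4, and a finite check over these trees finds one of the
-- patterns, read in one of the two directions, in that block. Trees of height at most 3 are
-- checked directly; the only failures are the three excluded cycles.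
module Submission where

open import Defs
open import Data.Empty using (⊥-elim)
open import Data.Fin using (Fin; zero; suc; toℕ; fromℕ<)
open import Data.Fin.Properties
  using (toℕ<n; toℕ-fromℕ<; fromℕ<-cong) renaming (any? to ∃-fin?; all? to ∀-fin?)
open import Data.List using (List; []; _∷_; _++_; _∷ʳ_; reverse; length; lookup)
open import Data.List.Properties
  using ( ++-assoc; ++-identityʳ; reverse-involutive; unfold-reverse; reverse-++; ∷-injective
        ; length-++; length-++-≤ˡ; ≡-dec)
open import Data.List.Relation.Binary.Infix.Heterogeneous
  using (Infix; MkView; toView; fromView; _++ⁱ_; _ⁱ++_; there)
open import Data.List.Relation.Binary.Infix.Heterogeneous.Properties
  using (fromPointwise; infix?) renaming (trans to infix-trans)
import Data.List.Relation.Binary.Pointwise as Pointwise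
open import Data.List.Relation.Unary.Any using (Any; any?)
import Data.List.Relation.Unary.Any as Any
open import Data.Nat using (ℕ; zero; suc; _+_; _⊔_; _≤_; _<_; _≟_; s≤s)
open import Data.Nat.DivMod using (m<n⇒m%n≡m)
open import Data.Nat.Properties
  using ( +-suc; +-comm; +-identityʳ; suc-injective; +-monoʳ-<; +-monoʳ-≤; ≤-reflexive; ≤-<-connex
        ; m≤n⇒m<n∨m≡n; ⊔-sel; m⊔n≤o⇒m≤o; m⊔n≤o⇒n≤o; module ≤-Reasoning)
open import Data.Product using (Σ; ∃; ∃₂; _×_; _,_)
open import Data.Sum using (_⊎_; inj₁; inj₂)
import Data.Sum as Sum
open import Function using (_∘_; _⇔_; mk⇔; Equivalence)
open import Function.Construct.Composition using (_⇔-∘_)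
open import Function.Construct.Identity using (⇔-id)
open import Function.Construct.Symmetry using (⇔-sym)
open import Relation.Binary.PropositionalEquality
open import Relation.Nullary using (¬_; Dec)
open import Relation.Nullary.Decidable using (_×-dec_; _⊎-dec_; _→-dec_; toWitness)
open import Relation.Unary using (Decidable)

data Tree : Set where
  leaf : Tree
  node : Tree → Tree → Tree

leftSpine : Tree → ℕ
leftSpine leaf       = 0
leftSpine (node A _) = suc (leftSpine A)

rightSpine : Tree → ℕ
rightSpine leaf       = 0
rightSpine (node _ B) = suc (rightSpine B)

height : Tree → ℕ
height leaf       = 0
height (node A B) = suc (height A ⊔ height B)

-- interior⁺ T y also lists the right end of T, which lies in y further triangles outside T.
interior⁺ : Tree → ℕ → List ℕ
interior⁺ leaf       y = y ∷ []
interior⁺ (node A B) y = interior⁺ A (suc (leftSpine B)) ++ interior⁺ B (suc y)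

interior : Tree → List ℕ
interior leaf       = []
interior (node A B) = interior⁺ A (suc (leftSpine B)) ++ interior B

cycle : Tree → List ℕ
cycle T = leftSpine T ∷ interior T ++ rightSpine T ∷ []

interior⁺≡interior∷ʳ : ∀ T y → interior⁺ T y ≡ interior T ∷ʳ (y + rightSpine T)
interior⁺≡interior∷ʳ leaf       y = cong (_∷ []) (sym (+-identityʳ y))
interior⁺≡interior∷ʳ (node A B) y = begin
  interior⁺ A a ++ interior⁺ B (suc y)
    ≡⟨ cong (interior⁺ A a ++_) (interior⁺≡interior∷ʳ B (suc y)) ⟩
  interior⁺ A a ++ interior B ∷ʳ (suc y + rightSpine B)
    ≡⟨ cong (λ z → interior⁺ A a ++ interior B ∷ʳ z) (+-suc y (rightSpine B)) ⟨
  interior⁺ A a ++ interior B ∷ʳ (y + rightSpine (node A B))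
    ≡⟨ ++-assoc (interior⁺ A a) (interior B) _ ⟨
  interior (node A B) ∷ʳ (y + rightSpine (node A B))
    ∎
  where
  open ≡-Reasoning
  a : ℕ
  a = suc (leftSpine B)

cycle≡leftSpine∷interior⁺ : ∀ T → cycle T ≡ leftSpine T ∷ interior⁺ T 0
cycle≡leftSpine∷interior⁺ T = cong (leftSpine T ∷_) (sym (interior⁺≡interior∷ʳ T 0))

rotate : {A : Set} → List A → List A
rotate []       = []
rotate (x ∷ xs) = xs ∷ʳ x

-- reroot T leaf turns the triangulation by one vertex; acc is the part already moved past the root.
reroot : Tree → Tree → Tree
reroot leaf       acc = acc
reroot (node A R) acc = reroot A (node R acc)

zipCycle : Tree → Tree → List ℕ
zipCycle T acc = (leftSpine T + rightSpine acc) ∷ interior⁺ T (leftSpine acc) ++ interior acc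

zipCycle-node : ∀ A R acc → zipCycle (node A R) acc ≡ zipCycle A (node R acc)
zipCycle-node A R acc = cong₂ _∷_ (sym (+-suc (leftSpine A) (rightSpine acc)))
  (++-assoc (interior⁺ A (suc (leftSpine R))) (interior⁺ R (suc (leftSpine acc))) (interior acc))

rotate-zipCycle : ∀ T acc → rotate (zipCycle T acc) ≡ cycle (reroot T acc)
rotate-zipCycle leaf       acc = refl
rotate-zipCycle (node A R) acc =
  trans (cong rotate (zipCycle-node A R acc)) (rotate-zipCycle A (node R acc))

rotate-cycle : ∀ T → rotate (cycle T) ≡ cycle (reroot T leaf)
rotate-cycle T = trans (cong rotate cycle≡zipCycle) (rotate-zipCycle T leaf)
  where
  cycle≡zipCycle : cycle T ≡ zipCycle T leaf
  cycle≡zipCycle = trans (cycle≡leftSpine∷interior⁺ T)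
    (cong₂ _∷_ (sym (+-identityʳ (leftSpine T))) (sym (++-identityʳ (interior⁺ T 0))))

mirror : Tree → Tree
mirror leaf       = leaf
mirror (node A B) = node (mirror B) (mirror A)

leftSpine-mirror : ∀ T → leftSpine (mirror T) ≡ rightSpine T
leftSpine-mirror leaf       = refl
leftSpine-mirror (node A B) = cong suc (leftSpine-mirror B)

rightSpine-mirror : ∀ T → rightSpine (mirror T) ≡ leftSpine T
rightSpine-mirror leaf       = refl
rightSpine-mirror (node A B) = cong suc (rightSpine-mirror A)

interior-mirror : ∀ T → interior (mirror T) ≡ reverse (interior T)
interior-mirror leaf       = refl
interior-mirror (node A B) = begin
  interior⁺ (mirror B) (suc (leftSpine (mirror A))) ++ interior (mirror A)
    ≡⟨ cong (_++ interior (mirror A)) (interior⁺≡interior∷ʳ (mirror B) _) ⟩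
  (interior (mirror B) ∷ʳ (suc (leftSpine (mirror A)) + rightSpine (mirror B))) ++ interior (mirror A)
    ≡⟨ cong₂ (λ u v → (u ∷ʳ suc v) ++ interior (mirror A)) (interior-mirror B) junction ⟩
  (reverse (interior B) ∷ʳ j) ++ interior (mirror A)
    ≡⟨ cong ((reverse (interior B) ∷ʳ j) ++_) (interior-mirror A) ⟩
  (reverse (interior B) ∷ʳ j) ++ reverse (interior A)
    ≡⟨ cong (_++ reverse (interior A)) (reverse-++ (j ∷ []) (interior B)) ⟨
  reverse (j ∷ interior B) ++ reverse (interior A)
    ≡⟨ reverse-++ (interior A) (j ∷ interior B) ⟨
  reverse (interior A ++ j ∷ interior B)
    ≡⟨ cong reverse (++-assoc (interior A) (j ∷ []) (interior B)) ⟨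
  reverse ((interior A ∷ʳ j) ++ interior B)
    ≡⟨ cong (λ u → reverse (u ++ interior B)) (interior⁺≡interior∷ʳ A _) ⟨
  reverse (interior (node A B))
    ∎
  where
  open ≡-Reasoning
  j : ℕ
  j = suc (leftSpine B + rightSpine A)
  junction : leftSpine (mirror A) + rightSpine (mirror B) ≡ leftSpine B + rightSpine A
  junction = trans (cong₂ _+_ (leftSpine-mirror A) (rightSpine-mirror B))
                   (+-comm (rightSpine A) (leftSpine B))

reverse-cycle : ∀ T → reverse (cycle T) ≡ cycle (mirror T)
reverse-cycle T = begin
  reverse (leftSpine T ∷ interior T ∷ʳ rightSpine T)
    ≡⟨ unfold-reverse (leftSpine T) (interior T ∷ʳ rightSpine T) ⟩
  reverse (interior T ∷ʳ rightSpine T) ∷ʳ leftSpine T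
    ≡⟨ cong (_∷ʳ leftSpine T) (reverse-++ (interior T) (rightSpine T ∷ [])) ⟩
  rightSpine T ∷ reverse (interior T) ∷ʳ leftSpine T
    ≡⟨ cong₂ (λ u v → u ∷ v ∷ʳ leftSpine T) (leftSpine-mirror T) (interior-mirror T) ⟨
  leftSpine (mirror T) ∷ interior (mirror T) ∷ʳ leftSpine T
    ≡⟨ cong (λ w → leftSpine (mirror T) ∷ interior (mirror T) ∷ʳ w) (rightSpine-mirror T) ⟨
  cycle (mirror T)
    ∎
  where open ≡-Reasoning

graft : Tree → Tree
graft leaf       = node leaf leaf
graft (node A B) = node (graft A) B

sucHead : List ℕ → List ℕ
sucHead []       = []
sucHead (x ∷ xs) = suc x ∷ xs

sucHead-++ : ∀ {xs x xs′} ys → xs ≡ x ∷ xs′ → sucHead (xs ++ ys) ≡ sucHead xs ++ ys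
sucHead-++ ys refl = refl

interior⁺-nonempty : ∀ T y → ∃₂ λ x xs → interior⁺ T y ≡ x ∷ xs
interior⁺-nonempty leaf       y = y , [] , refl
interior⁺-nonempty (node A B) y with interior⁺-nonempty A (suc (leftSpine B))
... | x , xs , eq = x , xs ++ interior⁺ B (suc y) , cong (_++ interior⁺ B (suc y)) eq

leftSpine-graft : ∀ T → leftSpine (graft T) ≡ suc (leftSpine T)
leftSpine-graft leaf       = refl
leftSpine-graft (node A B) = cong suc (leftSpine-graft A)

interior⁺-graft : ∀ T y → interior⁺ (graft T) y ≡ 1 ∷ sucHead (interior⁺ T y)
interior⁺-graft leaf       y = refl
interior⁺-graft (node A B) y with interior⁺-nonempty A (suc (leftSpine B))
... | _ , _ , nonempty = begin
  interior⁺ (graft A) a ++ interior⁺ B (suc y)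
    ≡⟨ cong (_++ interior⁺ B (suc y)) (interior⁺-graft A a) ⟩
  1 ∷ sucHead (interior⁺ A a) ++ interior⁺ B (suc y)
    ≡⟨ cong (1 ∷_) (sucHead-++ (interior⁺ B (suc y)) nonempty) ⟨
  1 ∷ sucHead (interior⁺ (node A B) y)
    ∎
  where
  open ≡-Reasoning
  a : ℕ
  a = suc (leftSpine B)

cycle-graft : ∀ T {c₁ c₂ cs} → cycle T ≡ c₁ ∷ c₂ ∷ cs → cycle (graft T) ≡ suc c₁ ∷ 1 ∷ suc c₂ ∷ cs
cycle-graft T {c₁} {c₂} {cs} eq with ∷-injective (trans (sym (cycle≡leftSpine∷interior⁺ T)) eq)
... | refl , interior⁺≡ = begin
  cycle (graft T)
    ≡⟨ cycle≡leftSpine∷interior⁺ (graft T) ⟩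
  leftSpine (graft T) ∷ interior⁺ (graft T) 0
    ≡⟨ cong₂ _∷_ (leftSpine-graft T) (interior⁺-graft T 0) ⟩
  suc c₁ ∷ 1 ∷ sucHead (interior⁺ T 0)
    ≡⟨ cong (λ xs → suc c₁ ∷ 1 ∷ sucHead xs) interior⁺≡ ⟩
  suc c₁ ∷ 1 ∷ suc c₂ ∷ cs
    ∎
  where open ≡-Reasoning

TreeCycle : List ℕ → Set
TreeCycle c = ∃ λ T → cycle T ≡ c

treeCycle-rotate : ∀ {x xs} → TreeCycle (x ∷ xs) → TreeCycle (xs ∷ʳ x)
treeCycle-rotate (T , eq) = reroot T leaf , trans (sym (rotate-cycle T)) (cong rotate eq)

treeCycle-reverse : ∀ {c} → TreeCycle c → TreeCycle (reverse c)
treeCycle-reverse (T , eq) = mirror T , trans (sym (reverse-cycle T)) (cong reverse eq)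

treeCycle-reverse⁻ : ∀ {c} → TreeCycle (reverse c) → TreeCycle c
treeCycle-reverse⁻ {c} = subst TreeCycle (reverse-involutive c) ∘ treeCycle-reverse

treeCycle-rotate⁻ : ∀ {x xs} → TreeCycle (xs ∷ʳ x) → TreeCycle (x ∷ xs)
treeCycle-rotate⁻ {x} {xs} =
  treeCycle-reverse⁻ ∘ subst TreeCycle (sym (unfold-reverse x xs)) ∘ treeCycle-rotate
  ∘ subst TreeCycle (reverse-++ xs (x ∷ [])) ∘ treeCycle-reverse

treeCycle-respects-Dih : ∀ {c c′} → Dih c c′ → TreeCycle c ⇔ TreeCycle c′
treeCycle-respects-Dih dih-refl        = ⇔-id _
treeCycle-respects-Dih dih-rot         = mk⇔ treeCycle-rotate treeCycle-rotate⁻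
treeCycle-respects-Dih dih-rev         = mk⇔ treeCycle-reverse treeCycle-reverse⁻
treeCycle-respects-Dih (dih-sym d)     = ⇔-sym (treeCycle-respects-Dih d)
treeCycle-respects-Dih (dih-trans d e) = treeCycle-respects-Dih e ⇔-∘ treeCycle-respects-Dih d

quiddity⇒treeCycle : ∀ {c} → Quiddity c → TreeCycle c
quiddity⇒treeCycle q-base      = leaf , refl
quiddity⇒treeCycle (q-dih d q) = Equivalence.to (treeCycle-respects-Dih d) (quiddity⇒treeCycle q)
quiddity⇒treeCycle (q-grow q) with quiddity⇒treeCycle q
... | T , eq = graft T , cycle-graft T eq

OccursAt : List ℕ → List ℕ → ℕ → Set
OccursAt d c k = (i : Fin (length d)) → cycAt c (k + toℕ i) ≡ lookup d i

Occurs : List ℕ → List ℕ → Set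
Occurs d c = Σ ℕ (OccursAt d c)

OccursEitherWay : List ℕ → List ℕ → Set
OccursEitherWay d c = Occurs d c ⊎ Occurs d (reverse c)

HasPattern : List ℕ → Set
HasPattern c = Any (λ d → OccursEitherWay d c) patterns

occursEitherWay⇒containedIn : ∀ {d c} → OccursEitherWay d c → ContainedIn d c
occursEitherWay⇒containedIn {c = c} (inj₁ (k , occ)) = c , dih-refl , k , occ
occursEitherWay⇒containedIn {c = c} (inj₂ (k , occ)) = reverse c , dih-rev , k , occ

lookup-++-middle : ∀ {A : Set} (p : List A) {d} q {k : Fin (length (p ++ d ++ q))}
                   (i : Fin (length d)) → toℕ k ≡ length p + toℕ i → lookup (p ++ d ++ q) k ≡ lookup d i
lookup-++-middle (x ∷ p) {d}     q {suc k} i       eq = lookup-++-middle p {d} q i (suc-injective eq)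
lookup-++-middle []      {y ∷ d}  q {zero}  zero    eq = refl
lookup-++-middle []      {y ∷ d}  q {suc k} (suc i) eq = lookup-++-middle [] {d} q i (suc-injective eq)

middle-index< : ∀ {A : Set} (p : List A) {d} q (i : Fin (length d)) →
                length p + toℕ i < length (p ++ d ++ q)
middle-index< p {d} q i = begin-strict
  length p + toℕ i           <⟨ +-monoʳ-< (length p) (toℕ<n i) ⟩
  length p + length d        ≤⟨ +-monoʳ-≤ (length p) (length-++-≤ˡ d) ⟩
  length p + length (d ++ q) ≡⟨ length-++ p ⟨
  length (p ++ d ++ q)       ∎
  where open ≤-Reasoning

cycAt-< : ∀ c {j} (j<n : j < length c) → cycAt c j ≡ lookup c (fromℕ< j<n)
cycAt-< (x ∷ xs) {j} j<n = cong (lookup (x ∷ xs)) (fromℕ<-cong _ _ (m<n⇒m%n≡m j<n) _ _)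

cycAt-++ : ∀ (p : List ℕ) {d} q (i : Fin (length d)) → cycAt (p ++ d ++ q) (length p + toℕ i) ≡ lookup d i
cycAt-++ p {d} q i =
  trans (cycAt-< (p ++ d ++ q) (middle-index< p q i)) (lookup-++-middle p {d} q i (toℕ-fromℕ< _))

infix⇒occurs : ∀ {d c} → Infix _≡_ d c → Occurs d c
infix⇒occurs inf with MkView p pw q ← toView inf with refl ← Pointwise.Pointwise-≡⇒≡ pw =
  length p , cycAt-++ p q

infix-refl : ∀ {A : Set} {xs : List A} → Infix _≡_ xs xs
infix-refl = fromPointwise (Pointwise.refl refl)

infix-reverse : ∀ {A : Set} {xs ys : List A} → Infix _≡_ xs ys → Infix _≡_ (reverse xs) (reverse ys)
infix-reverse inf with MkView p {m} pw q ← toView inf =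
  subst (Infix _≡_ _) (sym reverse-++₃)
        (fromView (MkView (reverse q) (Pointwise.reverse⁺ pw) (reverse p)))
  where
  reverse-++₃ : reverse (p ++ m ++ q) ≡ reverse q ++ reverse m ++ reverse p
  reverse-++₃ = begin
    reverse (p ++ m ++ q)                 ≡⟨ reverse-++ p (m ++ q) ⟩
    reverse (m ++ q) ++ reverse p         ≡⟨ cong (_++ reverse p) (reverse-++ m q) ⟩
    (reverse q ++ reverse m) ++ reverse p ≡⟨ ++-assoc (reverse q) (reverse m) (reverse p) ⟩
    reverse q ++ reverse m ++ reverse p   ∎
    where open ≡-Reasoning

InfixEitherWay : List ℕ → List ℕ → Set
InfixEitherWay d s = Infix _≡_ d s ⊎ Infix _≡_ d (reverse s)

infixEitherWay⇒occursEitherWay : ∀ {d s c} → Infix _≡_ s c → InfixEitherWay d s → OccursEitherWay d c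
infixEitherWay⇒occursEitherWay s⊆c (inj₁ d⊆s)  = inj₁ (infix⇒occurs (infix-trans trans d⊆s s⊆c))
infixEitherWay⇒occursEitherWay s⊆c (inj₂ d⊆s′) =
  inj₂ (infix⇒occurs (infix-trans trans d⊆s′ (infix-reverse s⊆c)))

interior-infix-cycle : ∀ T → Infix _≡_ (interior T) (cycle T)
interior-infix-cycle T = there (infix-refl ⁱ++ (rightSpine T ∷ []))

interior-infix-nodeˡ : ∀ A B → Infix _≡_ (interior A) (interior (node A B))
interior-infix-nodeˡ A B = subst (λ s → Infix _≡_ (interior A) (s ++ interior B))
  (sym (interior⁺≡interior∷ʳ A _)) ((infix-refl ⁱ++ (_ ∷ [])) ⁱ++ interior B)

interior-infix-nodeʳ : ∀ A B → Infix _≡_ (interior B) (interior (node A B))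
interior-infix-nodeʳ A B = interior⁺ A (suc (leftSpine B)) ++ⁱ infix-refl

ContainsInteriorOfHeight : ℕ → List ℕ → Set
ContainsInteriorOfHeight n s = ∃ λ S → height S ≡ n × Infix _≡_ (interior S) s

containsInteriorOfHeight-infix : ∀ {n s t} → Infix _≡_ s t →
                                 ContainsInteriorOfHeight n s → ContainsInteriorOfHeight n t
containsInteriorOfHeight-infix s⊆t (S , hS , S⊆s) = S , hS , infix-trans trans S⊆s s⊆t

interior-containsInteriorOfHeight : ∀ {n} T → n ≤ height T → ContainsInteriorOfHeight n (interior T)
interior-containsInteriorOfHeight T n≤h with m≤n⇒m<n∨m≡n n≤h
... | inj₂ refl = T , refl , infix-refl
interior-containsInteriorOfHeight leaf       _ | inj₁ ()
interior-containsInteriorOfHeight (node A B) _ | inj₁ (s≤s n≤h) with ⊔-sel (height A) (height B)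
... | inj₁ h≡hA = containsInteriorOfHeight-infix (interior-infix-nodeˡ A B)
                    (interior-containsInteriorOfHeight A (subst (_ ≤_) h≡hA n≤h))
... | inj₂ h≡hB = containsInteriorOfHeight-infix (interior-infix-nodeʳ A B)
                    (interior-containsInteriorOfHeight B (subst (_ ≤_) h≡hB n≤h))

AllUpToHeight : ℕ → (Tree → Set) → Set
AllUpToHeight zero    P = P leaf
AllUpToHeight (suc n) P = P leaf × AllUpToHeight n (λ A → AllUpToHeight n (λ B → P (node A B)))

allUpToHeight? : ∀ n {P : Tree → Set} → Decidable P → Dec (AllUpToHeight n P)
allUpToHeight? zero    P? = P? leaf
allUpToHeight? (suc n) P? =
  P? leaf ×-dec allUpToHeight? n (λ A → allUpToHeight? n (λ B → P? (node A B)))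

allUpToHeight⇒ : ∀ n {P : Tree → Set} → AllUpToHeight n P → ∀ T → height T ≤ n → P T
allUpToHeight⇒ zero    P-leaf       leaf       _       = P-leaf
allUpToHeight⇒ (suc n) (P-leaf , _) leaf       _       = P-leaf
allUpToHeight⇒ (suc n) (_ , P-node) (node A B) (s≤s h) =
  allUpToHeight⇒ n (allUpToHeight⇒ n P-node A (m⊔n≤o⇒m≤o _ _ h)) B (m⊔n≤o⇒n≤o _ _ h)

infixEitherWay? : ∀ d s → Dec (InfixEitherWay d s)
infixEitherWay? d s = infix? _≟_ d s ⊎-dec infix? _≟_ d (reverse s)

InteriorHasPattern : Tree → Set
InteriorHasPattern S = Any (λ d → InfixEitherWay d (interior S)) patterns

height4-interiorHasPattern : ∀ S → height S ≡ 4 → InteriorHasPattern S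
height4-interiorHasPattern S hS =
  allUpToHeight⇒ 4 {λ S → height S ≡ 4 → InteriorHasPattern S} checked S (≤-reflexive hS) hS
  where
  checked : AllUpToHeight 4 (λ S → height S ≡ 4 → InteriorHasPattern S)
  checked = toWitness {a? = allUpToHeight? 4 (λ S →
    height S ≟ 4 →-dec any? (λ d → infixEitherWay? d (interior S)) patterns)} _

tallTree-pattern : ∀ T → 4 ≤ height T → HasPattern (cycle T)
tallTree-pattern T 4≤h with interior-containsInteriorOfHeight T 4≤h
... | S , hS , S⊆T =
  Any.map (infixEitherWay⇒occursEitherWay (infix-trans trans S⊆T (interior-infix-cycle T)))
          (height4-interiorHasPattern S hS)

OccursAtIndex : List ℕ → List ℕ → Set
OccursAtIndex d c = ∃ λ (k : Fin (length c)) → OccursAt d c (toℕ k)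

occursAtIndex? : ∀ d c → Dec (OccursAtIndex d c)
occursAtIndex? d c = ∃-fin? (λ k → ∀-fin? (λ i → cycAt c (toℕ k + toℕ i) ≟ lookup d i))

occursAtIndexEitherWay? : ∀ d c → Dec (OccursAtIndex d c ⊎ OccursAtIndex d (reverse c))
occursAtIndexEitherWay? d c = occursAtIndex? d c ⊎-dec occursAtIndex? d (reverse c)

Exceptional : List ℕ → Set
Exceptional c =
  c ≡ 0 ∷ 0 ∷ [] ⊎ c ≡ 1 ∷ 1 ∷ 1 ∷ [] ⊎ c ≡ 1 ∷ 2 ∷ 1 ∷ 2 ∷ [] ⊎ c ≡ 2 ∷ 1 ∷ 2 ∷ 1 ∷ []

exceptional? : ∀ c → Dec (Exceptional c)
exceptional? c =
  c ≡? (0 ∷ 0 ∷ []) ⊎-dec c ≡? (1 ∷ 1 ∷ 1 ∷ [])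
    ⊎-dec c ≡? (1 ∷ 2 ∷ 1 ∷ 2 ∷ []) ⊎-dec c ≡? (2 ∷ 1 ∷ 2 ∷ 1 ∷ [])
  where
  _≡?_ : ∀ (xs ys : List ℕ) → Dec (xs ≡ ys)
  _≡?_ = ≡-dec _≟_

exceptional⇒dih : ∀ {c} → Exceptional c →
                  Dih c (0 ∷ 0 ∷ []) ⊎ Dih c (1 ∷ 1 ∷ 1 ∷ []) ⊎ Dih c (1 ∷ 2 ∷ 1 ∷ 2 ∷ [])
exceptional⇒dih (inj₁ refl)               = inj₁ dih-refl
exceptional⇒dih (inj₂ (inj₁ refl))        = inj₂ (inj₁ dih-refl)
exceptional⇒dih (inj₂ (inj₂ (inj₁ refl))) = inj₂ (inj₂ dih-refl)
exceptional⇒dih (inj₂ (inj₂ (inj₂ refl))) = inj₂ (inj₂ dih-rot)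

HasPatternAtIndex : List ℕ → Set
HasPatternAtIndex c = Any (λ d → OccursAtIndex d c ⊎ OccursAtIndex d (reverse c)) patterns

shortTree-pattern : ∀ T → height T ≤ 3 → HasPatternAtIndex (cycle T) ⊎ Exceptional (cycle T)
shortTree-pattern = allUpToHeight⇒ 3 {λ T → HasPatternAtIndex (cycle T) ⊎ Exceptional (cycle T)}
  (toWitness {a? = allUpToHeight? 3 (λ T →
    any? (λ d → occursAtIndexEitherWay? d (cycle T)) patterns ⊎-dec exceptional? (cycle T))} _)

occursAtIndex⇒occurs : ∀ {d c} → OccursAtIndex d c → Occurs d c
occursAtIndex⇒occurs (k , occ) = toℕ k , occ

hasPatternAtIndex⇒hasPattern : ∀ c → HasPatternAtIndex c → HasPattern c
hasPatternAtIndex⇒hasPattern c =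
  Any.map λ {d} → Sum.map (occursAtIndex⇒occurs {d} {c}) (occursAtIndex⇒occurs {d} {reverse c})

treeCycle-pattern : ∀ T → HasPattern (cycle T) ⊎ Exceptional (cycle T)
treeCycle-pattern T with ≤-<-connex (height T) 3
... | inj₂ 3<h = inj₁ (tallTree-pattern T 3<h)
... | inj₁ h≤3 = Sum.map₁ (hasPatternAtIndex⇒hasPattern (cycle T)) (shortTree-pattern T h≤3)

corollary1p2 : (c : List ℕ) → Quiddity c
    → ¬ Dih c (0 ∷ 0 ∷ [])
    → ¬ Dih c (1 ∷ 1 ∷ 1 ∷ [])
    → ¬ Dih c (1 ∷ 2 ∷ 1 ∷ 2 ∷ [])
    → Any (λ d → ContainedIn d c) patterns
corollary1p2 c q c≁00 c≁111 c≁1212 with quiddity⇒treeCycle q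
... | T , refl with treeCycle-pattern T
...   | inj₁ found = Any.map (λ {d} → occursEitherWay⇒containedIn {d}) found
...   | inj₂ exceptional with exceptional⇒dih exceptional
...     | inj₁ c∼00         = ⊥-elim (c≁00 c∼00)
...     | inj₂ (inj₁ c∼111)  = ⊥-elim (c≁111 c∼111)
...     | inj₂ (inj₂ c∼1212) = ⊥-elim (c≁1212 c∼1212)
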